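{- Let $\mathcal G=(V,\mathcal E)$ be a graph (loops allowed) such that $\mathcal G^0$ is the complete graph $K_n$ for some $n\ge 2$. Then $\mathcal G$ is join-irreducible if and only if the number of loops of $\mathcal G$ is $0$, $1$, $n-1$ or $n$.
   Context: A graph $\mathcal G=(V,\mathcal E)$ has finite vertex set $V=\{1,\dots,n\}$ and $\mathcal E\subseteq[V]^2\cup[V]^1$ (singletons are loops); $\mathcal G^0=(V,\mathcal E\cap[V]^2)$. $f_{\mathcal G}$ is the Boolean function computed by the $GF(2)$ polynomial $\sum_{E\in\mathcal E}\prod_{i\in E}x_i$, and $\mathcal G$ is join-irreducible if $f_{\mathcal G}$ is. For Boolean functions, $g\le f$ if there is $\sigma$ with $g(a_1,\dots,a_m)=f(a_{\sigma(1)},\dots,a_{\sigma(n)})$ for all $a_i$; $g<f$ if $g\le f$ and $f\not\le g$; $f$ is join-irreducible if some $f'<f$ satisfies $g\le f'$ for all $g<f$. -}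

module Defs where

open import Data.Nat using (ℕ; zero; suc)
open import Data.Bool using (Bool; true; false; _∧_; _xor_)
open import Data.Fin using (Fin; zero; suc; _<?_) renaming (_<_ to _<ᶠ_)
open import Data.Fin.Subset using (Subset)
open import Data.Vec using (lookup)
open import Data.Product using (Σ; ∃; _×_; _,_)
open import Relation.Nullary using (¬_; does)
open import Relation.Binary.PropositionalEquality using (_≡_)

BFun : Set
BFun = Σ ℕ (λ m → (Fin m → Bool) → Bool)

_≼_ : BFun → BFun → Set
(m , g) ≼ (n , f) = Σ (Fin n → Fin m) λ σ → ∀ (a : Fin m → Bool) → g a ≡ f (λ i → a (σ i))

_≺_ : BFun → BFun → Set
g ≺ f = g ≼ f × ¬ (f ≼ g)

JoinIrreducible : BFun → Set
JoinIrreducible f = Σ BFun λ f' → f' ≺ f × (∀ g → g ≺ f → g ≼ f')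

parity : ∀ {n} → (Fin n → Bool) → Bool
parity {zero}  h = false
parity {suc n} h = h zero xor parity (λ i → h (suc i))

-- The 2-element edge {i,j} with
-- i < j belongs to 𝓔 iff edge i j ≡ true (values of edge i j for i ≥ j are
-- ignored); the loop {i} belongs to 𝓔 iff i ∈ loops.
record Graph (n : ℕ) : Set where
  field
    edge  : Fin n → Fin n → Bool
    loops : Subset n
open Graph public

-- f_𝓖 : the Boolean function of the GF(2) polynomial Σ_{E∈𝓔} Π_{i∈E} x_i.
fG : ∀ {n} → Graph n → (Fin n → Bool) → Bool
fG G x =
  parity (λ i → parity (λ j → does (i <? j) ∧ edge G i j ∧ x i ∧ x j))
  xor parity (λ i → lookup (loops G) i ∧ x i)

boolFun : ∀ {n} → Graph n → BFun
boolFun {n} G = n , fG G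

IsCompleteSimplePart : ∀ {n} → Graph n → Set
IsCompleteSimplePart {n} G = ∀ (i j : Fin n) → i <ᶠ j → edge G i j ≡ true

-- For 𝓖⁰ = Kₙ with loop set L, f_𝓖(x) = (|x| choose 2) + |L ∩ x| mod 2. This function depends on
-- all its variables, so the functions strictly below it are those below one of its identification
-- minors f(x_a = x_b), and it is join-irreducible iff one identification minor dominates all others.
-- If at most one vertex has the minority loop type this holds: f is invariant under permutations
-- preserving L, which carry any two vertices of equal type to a fixed such pair, and identifying a
-- loop with a non-loop makes their common variable irrelevant. With two loops and two non-loops, a
-- dominating minor would make the identifications of two loops and of two non-loops relabellings of
-- one another, but they send k - 1 and k + 1 unit vectors to 1 (k the number of loops).

module Submission where

open import Defs
open import Data.Nat using (ℕ; zero; suc; _+_; _≤_; _∸_; z≤n; s≤s; s≤s⁻¹)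
import Data.Nat.Properties as ℕ
open import Data.Nat.Tactic.RingSolver using (solve-∀)
open import Data.Bool using (Bool; true; false; not; _∧_; _∨_; _xor_)
import Data.Bool.Properties as 𝔹
open import Data.Fin using (Fin; zero; suc; punchIn; punchOut; _<?_)
open import Data.Fin.Properties
  using (_≟_; suc-injective; any?; punchInᵢ≢i; punchIn-injective; punchIn-punchOut; punchOut-punchIn;
         punchOut-cong; pigeonhole; <⇒≢)
open import Data.Fin.Permutation as Perm using (Permutation; _⟨$⟩ʳ_; _⟨$⟩ˡ_; transpose)
open import Data.Fin.Subset using (Subset; ∣_∣)
open import Data.Vec using ([]; _∷_; lookup)
open import Data.Vec.Functional using (updateAt)
open import Data.Vec.Functional.Properties using (updateAt-updates; updateAt-minimal)
open import Data.Product using (∃; ∃₂; _×_; _,_; proj₁; proj₂)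
open import Data.Sum using (_⊎_; inj₁; inj₂)
open import Data.Empty using (⊥)
open import Function using (_∘_; const)
open import Function.Bundles using (_⇔_; mk⇔)
open import Function.Definitions using (Injective)
open import Relation.Nullary using (¬_; Dec; yes; no; does; contradiction)
open import Relation.Nullary.Decidable using (dec-true; dec-false; ¬?; _×-dec_; decidable-stable)
open import Relation.Binary.PropositionalEquality
  using (_≡_; _≢_; _≗_; refl; sym; trans; cong; cong₂; subst; subst₂; module ≡-Reasoning)
open import Algebra.Properties.CommutativeMonoid.Sum ℕ.+-0-commutativeMonoid
  using (sum; sum-cong-≗; sum-replicate-zero; ∑-distrib-+; ∑-comm; sum-permute)

open ≡-Reasoning

sum-zero : ∀ {n} {h : Fin n → ℕ} → (∀ u → h u ≡ 0) → sum h ≡ 0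
sum-zero {n} h≗0 = trans (sum-cong-≗ h≗0) (sum-replicate-zero n)

sum-const-1 : ∀ n → sum {n} (const 1) ≡ n
sum-const-1 zero    = refl
sum-const-1 (suc n) = cong suc (sum-const-1 n)

sum-mono : ∀ {n} {h h′ : Fin n → ℕ} → (∀ u → h u ≤ h′ u) → sum h ≤ sum h′
sum-mono {zero}  h≤h′ = z≤n
sum-mono {suc n} h≤h′ = ℕ.+-mono-≤ (h≤h′ zero) (sum-mono (h≤h′ ∘ suc))

sum-exchange : ∀ {n} (p : Fin n) {h h′ : Fin n → ℕ} → (∀ u → u ≢ p → h u ≡ h′ u) →
               sum h + h′ p ≡ sum h′ + h p
sum-exchange zero {h} {h′} agree = begin
  h zero + sum (h ∘ suc) + h′ zero   ≡⟨ cong (λ t → h zero + t + h′ zero) (sum-cong-≗ λ u → agree (suc u) λ ()) ⟩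
  h zero + sum (h′ ∘ suc) + h′ zero  ≡⟨ swap (h zero) (sum (h′ ∘ suc)) (h′ zero) ⟩
  h′ zero + sum (h′ ∘ suc) + h zero  ∎
  where
  swap : ∀ a s b → a + s + b ≡ b + s + a
  swap = solve-∀
sum-exchange (suc p) {h} {h′} agree = begin
  h zero + sum (h ∘ suc) + h′ (suc p)    ≡⟨ ℕ.+-assoc (h zero) _ _ ⟩
  h zero + (sum (h ∘ suc) + h′ (suc p))  ≡⟨ cong₂ _+_ (agree zero λ ()) (sum-exchange p λ u u≢p → agree (suc u) (u≢p ∘ suc-injective)) ⟩
  h′ zero + (sum (h′ ∘ suc) + h (suc p)) ≡⟨ ℕ.+-assoc (h′ zero) _ _ ⟨
  h′ zero + sum (h′ ∘ suc) + h (suc p)   ∎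

sum-point : ∀ {n} (p : Fin n) {h : Fin n → ℕ} → (∀ u → u ≢ p → h u ≡ 0) → sum h ≡ h p
sum-point {n} p {h} vanish = begin
  sum h                    ≡⟨ ℕ.+-identityʳ (sum h) ⟨
  sum h + 0                ≡⟨ sum-exchange p vanish ⟩
  sum {n} (const 0) + h p  ≡⟨ cong (_+ h p) (sum-zero {n} λ _ → refl) ⟩
  h p                      ∎

sum-exchange₂ : ∀ {n} {p q : Fin n} → p ≢ q → {h h′ : Fin n → ℕ} →
                (∀ u → u ≢ p → u ≢ q → h u ≡ h′ u) →
                sum h + (h′ p + h′ q) ≡ sum h′ + (h p + h q)
sum-exchange₂ {p = p} {q} p≢q {h} {h′} agree = begin
  sum h + (h′ p + h′ q)   ≡⟨ ℕ.+-assoc (sum h) _ _ ⟨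
  sum h + h′ p + h′ q     ≡⟨ cong (λ t → sum h + t + h′ q) (updateAt-updates p h) ⟨
  sum h + mid p + h′ q    ≡⟨ cong (_+ h′ q) (sum-exchange p agree-p) ⟩
  sum mid + h p + h′ q    ≡⟨ swap (sum mid) (h p) (h′ q) ⟩
  sum mid + h′ q + h p    ≡⟨ cong (_+ h p) (sum-exchange q agree-q) ⟩
  sum h′ + mid q + h p    ≡⟨ cong (λ t → sum h′ + t + h p) (updateAt-minimal q p h (p≢q ∘ sym)) ⟩
  sum h′ + h q + h p      ≡⟨ swap′ (sum h′) (h q) (h p) ⟩
  sum h′ + (h p + h q)    ∎
  where
  mid : Fin _ → ℕ
  mid = updateAt h p (const (h′ p))
  agree-p : ∀ u → u ≢ p → h u ≡ mid u
  agree-p u u≢p = sym (updateAt-minimal u p h u≢p)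
  agree-q : ∀ u → u ≢ q → mid u ≡ h′ u
  agree-q u u≢q with u ≟ p
  ... | yes refl = updateAt-updates p h
  ... | no u≢p   = trans (updateAt-minimal u p h u≢p) (agree u u≢p u≢q)
  swap : ∀ a b c → a + b + c ≡ a + c + b
  swap = solve-∀
  swap′ : ∀ a b c → a + b + c ≡ a + (c + b)
  swap′ = solve-∀

sum-pair : ∀ {n} {p q : Fin n} → p ≢ q → {h : Fin n → ℕ} →
           (∀ u → u ≢ p → u ≢ q → h u ≡ 0) → sum h ≡ h p + h q
sum-pair {n} {p} {q} p≢q {h} vanish = begin
  sum h                            ≡⟨ ℕ.+-identityʳ (sum h) ⟨
  sum h + 0                        ≡⟨ sum-exchange₂ p≢q vanish ⟩
  sum {n} (const 0) + (h p + h q)  ≡⟨ cong (_+ (h p + h q)) (sum-zero {n} λ _ → refl) ⟩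
  h p + h q                        ∎

term≤sum : ∀ {n} (p : Fin n) (h : Fin n → ℕ) → h p ≤ sum h
term≤sum p h = ℕ.≤-trans (ℕ.m≤n+m (h p) _)
  (ℕ.≤-reflexive (trans (sym (sum-exchange p {h} {updateAt h p (const 0)} (λ u u≢p → sym (updateAt-minimal u p h u≢p))))
                        (trans (cong (sum h +_) (updateAt-updates p h)) (ℕ.+-identityʳ (sum h)))))

sum-mono-tight : ∀ {n} {h h′ : Fin n → ℕ} → (∀ u → h u ≤ h′ u) → sum h′ ≡ sum h → ∀ v → h′ v ≡ h v
sum-mono-tight {h = h} {h′} h≤h′ sums≡ v = ℕ.≤-antisym (ℕ.+-cancelˡ-≤ (sum h′) _ _ bound) (h≤h′ v)
  where
  mid = updateAt h′ v (const (h v))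
  h≤mid : ∀ u → h u ≤ mid u
  h≤mid u with u ≟ v
  ... | yes refl = ℕ.≤-reflexive (sym (updateAt-updates v h′))
  ... | no u≢v   = subst (h u ≤_) (sym (updateAt-minimal u v h′ u≢v)) (h≤h′ u)
  bound : sum h′ + h′ v ≤ sum h′ + h v
  bound = ℕ.≤-trans (ℕ.≤-reflexive (cong (_+ h′ v) sums≡))
            (ℕ.≤-trans (ℕ.+-monoˡ-≤ (h′ v) (sum-mono h≤mid))
              (ℕ.≤-reflexive (trans (sum-exchange v (λ u u≢v → updateAt-minimal u v h′ u≢v))
                                    (cong (sum h′ +_) (updateAt-updates v h′)))))

boolToℕ : Bool → ℕ
boolToℕ false = 0
boolToℕ true  = 1

count : ∀ {n} → (Fin n → Bool) → ℕ
count x = sum (boolToℕ ∘ x)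

∣p∣≡count : ∀ {n} (p : Subset n) → ∣ p ∣ ≡ count (lookup p)
∣p∣≡count []          = refl
∣p∣≡count (true ∷ p)  = cong suc (∣p∣≡count p)
∣p∣≡count (false ∷ p) = ∣p∣≡count p

count-+-count-not : ∀ {n} (x : Fin n → Bool) → count x + count (not ∘ x) ≡ n
count-+-count-not {n} x = begin
  count x + count (not ∘ x)                        ≡⟨ ∑-distrib-+ (boolToℕ ∘ x) (boolToℕ ∘ not ∘ x) ⟨
  sum (λ u → boolToℕ (x u) + boolToℕ (not (x u)))  ≡⟨ sum-cong-≗ (λ u → bit+not-bit (x u)) ⟩
  sum {n} (const 1)                                ≡⟨ sum-const-1 n ⟩
  n                                                ∎
  where
  bit+not-bit : ∀ b → boolToℕ b + boolToℕ (not b) ≡ 1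
  bit+not-bit false = refl
  bit+not-bit true  = refl

count≡0⇒false : ∀ {n} (x : Fin n → Bool) → count x ≡ 0 → ∀ u → x u ≡ false
count≡0⇒false x count≡0 u with x u in xu≡
... | false = refl
... | true  = contradiction (subst (1 ≤_) count≡0 (subst (_≤ count x) (cong boolToℕ xu≡) (term≤sum u (boolToℕ ∘ x)))) λ ()

count≥1⇒true : ∀ {n} (x : Fin n → Bool) → 1 ≤ count x → ∃ λ u → x u ≡ true
count≥1⇒true {suc n} x count≥1 with x zero in x0≡
... | true  = zero , x0≡
... | false = let u , xu≡ = count≥1⇒true (x ∘ suc) count≥1 in suc u , xu≡

count-erase : ∀ {n} (x : Fin n → Bool) {p} → x p ≡ true → count x ≡ suc (count (updateAt x p (const false)))
count-erase x {p} xp≡ = begin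
  count x                   ≡⟨ ℕ.+-identityʳ (count x) ⟨
  count x + 0               ≡⟨ cong (λ b → count x + boolToℕ b) (updateAt-updates p x) ⟨
  count x + boolToℕ (x′ p)  ≡⟨ sum-exchange p (λ u u≢p → cong boolToℕ (sym (updateAt-minimal u p x u≢p))) ⟩
  count x′ + boolToℕ (x p)  ≡⟨ cong (λ b → count x′ + boolToℕ b) xp≡ ⟩
  count x′ + 1              ≡⟨ ℕ.+-comm (count x′) 1 ⟩
  suc (count x′)            ∎
  where
  x′ = updateAt x p (const false)

count≥2⇒another : ∀ {n} (x : Fin n → Bool) {p} → x p ≡ true → 2 ≤ count x → ∃ λ u → u ≢ p × x u ≡ true
count≥2⇒another x {p} xp≡ count≥2 =
  lift (count≥1⇒true x′ (s≤s⁻¹ (subst (2 ≤_) (count-erase x xp≡) count≥2)))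
  where
  x′ = updateAt x p (const false)
  lift : (∃ λ u → x′ u ≡ true) → ∃ λ u → u ≢ p × x u ≡ true
  lift (u , x′u≡) = u , u≢p , trans (sym (updateAt-minimal u p x u≢p)) x′u≡
    where
    u≢p : u ≢ p
    u≢p u≡p = contradiction (trans (sym x′u≡) (trans (cong x′ u≡p) (updateAt-updates p x))) λ ()

count≥2⇒two : ∀ {n} (x : Fin n → Bool) → 2 ≤ count x → ∃₂ λ a b → a ≢ b × x a ≡ true × x b ≡ true
count≥2⇒two x count≥2 =
  let a , xa≡ = count≥1⇒true x (ℕ.≤-trans (s≤s z≤n) count≥2)
      b , b≢a , xb≡ = count≥2⇒another x xa≡ count≥2
  in a , b , b≢a ∘ sym , xa≡ , xb≡

two⇒count≥2 : ∀ {n} (x : Fin n → Bool) {i j} → i ≢ j → x i ≡ true → x j ≡ true → 2 ≤ count x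
two⇒count≥2 x {i} {j} i≢j xi≡ xj≡ = subst (2 ≤_) (sym (count-erase x xi≡))
  (s≤s (subst (_≤ count x′) (cong boolToℕ x′j≡) (term≤sum j (boolToℕ ∘ x′))))
  where
  x′ = updateAt x i (const false)
  x′j≡ : x′ j ≡ true
  x′j≡ = trans (updateAt-minimal j i x (i≢j ∘ sym)) xj≡

count≤1⇒unique : ∀ {n} (x : Fin n → Bool) → count x ≤ 1 → ∀ {i j} → x i ≡ true → x j ≡ true → i ≡ j
count≤1⇒unique x count≤1 {i} {j} xi≡ xj≡ =
  decidable-stable (i ≟ j) λ i≢j → contradiction (ℕ.≤-trans (two⇒count≥2 x i≢j xi≡ xj≡) count≤1) λ { (s≤s ()) }

count≡2⇒pair : ∀ {n} (x : Fin n → Bool) {i j} → i ≢ j → x i ≡ true → x j ≡ true → count x ≡ 2 →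
               ∀ u → u ≢ i → u ≢ j → x u ≡ false
count≡2⇒pair x {i} {j} i≢j xi≡ xj≡ count≡2 u u≢i u≢j = begin
  x u    ≡⟨ updateAt-minimal u i x u≢i ⟨
  x′ u   ≡⟨ updateAt-minimal u j x′ u≢j ⟨
  x″ u   ≡⟨ count≡0⇒false x″ count″≡0 u ⟩
  false  ∎
  where
  x′ = updateAt x i (const false)
  x″ = updateAt x′ j (const false)
  x′j≡ : x′ j ≡ true
  x′j≡ = trans (updateAt-minimal j i x (i≢j ∘ sym)) xj≡
  count″≡0 : count x″ ≡ 0
  count″≡0 = ℕ.suc-injective (ℕ.suc-injective
    (trans (sym (trans (count-erase x xi≡) (cong suc (count-erase x′ x′j≡)))) count≡2))

odd : ℕ → Bool
odd zero    = false
odd (suc w) = not (odd w)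

-- Parity of the binomial coefficient (w choose 2), via (w+1 choose 2) = (w choose 2) + w.
oddChoose2 : ℕ → Bool
oddChoose2 zero    = false
oddChoose2 (suc w) = oddChoose2 w xor odd w

-- f_𝓖 for 𝓖⁰ = Kₙ with loop set L: an input with support S meets (|S| choose 2) edges and |L ∩ S| loops.
fK : ∀ {n} → (Fin n → Bool) → (Fin n → Bool) → Bool
fK L x = oddChoose2 (count x) xor odd (count (λ u → L u ∧ x u))

parity-cong : ∀ {n} {h h′ : Fin n → Bool} → h ≗ h′ → parity h ≡ parity h′
parity-cong {zero}  h≗h′ = refl
parity-cong {suc n} h≗h′ = cong₂ _xor_ (h≗h′ zero) (parity-cong (h≗h′ ∘ suc))

parity≡odd∘count : ∀ {n} (h : Fin n → Bool) → parity h ≡ odd (count h)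
parity≡odd∘count {zero}  h = refl
parity≡odd∘count {suc n} h with h zero
... | true  = cong not (parity≡odd∘count (h ∘ suc))
... | false = parity≡odd∘count (h ∘ suc)

parity-∧ : ∀ {n} b (h : Fin n → Bool) → parity (λ j → b ∧ h j) ≡ b ∧ parity h
parity-∧ true  h = refl
parity-∧ {n} false h = parity-false {n}
  where
  parity-false : ∀ {n} → parity {n} (const false) ≡ false
  parity-false {zero}  = refl
  parity-false {suc n} = parity-false {n}

pairs-parity : ∀ {n} (x : Fin n → Bool) →
               parity (λ i → parity (λ j → does (i <? j) ∧ (x i ∧ x j))) ≡ oddChoose2 (count x)
pairs-parity {zero}  x = refl
pairs-parity {suc n} x = trans (cong₂ _xor_ first-row (pairs-parity (x ∘ suc))) (add-vertex (x zero))
  where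
  c = count (x ∘ suc)
  first-row : parity (λ j → x zero ∧ x (suc j)) ≡ x zero ∧ odd c
  first-row = trans (parity-∧ (x zero) (x ∘ suc)) (cong (x zero ∧_) (parity≡odd∘count (x ∘ suc)))
  add-vertex : ∀ b → (b ∧ odd c) xor oddChoose2 c ≡ oddChoose2 (boolToℕ b + c)
  add-vertex true  = 𝔹.xor-comm (odd c) (oddChoose2 c)
  add-vertex false = refl

fG≗fK : ∀ {n} (G : Graph n) → IsCompleteSimplePart G → fG G ≗ fK (lookup (loops G))
fG≗fK G complete x =
  cong₂ _xor_ (trans (parity-cong λ i → parity-cong λ j → drop-edge i j) (pairs-parity x))
              (parity≡odd∘count (λ i → lookup (loops G) i ∧ x i))
  where
  drop-edge : ∀ i j → does (i <? j) ∧ edge G i j ∧ x i ∧ x j ≡ does (i <? j) ∧ (x i ∧ x j)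
  drop-edge i j = drop (i <? j) (complete i j)
    where
    drop : ∀ {P : Set} (P? : Dec P) → (P → edge G i j ≡ true) →
           does P? ∧ edge G i j ∧ x i ∧ x j ≡ does P? ∧ (x i ∧ x j)
    drop (yes p) edge≡ rewrite edge≡ p = refl
    drop (no _)  _     = refl

odd-boolToℕ : ∀ b → odd (boolToℕ b) ≡ b
odd-boolToℕ false = refl
odd-boolToℕ true  = refl

boolToℕ-∧-false : ∀ a {b} → b ≡ false → boolToℕ (a ∧ b) ≡ 0
boolToℕ-∧-false a refl = cong boolToℕ (𝔹.∧-zeroʳ a)

boolToℕ-∧-true : ∀ a {b} → b ≡ true → boolToℕ (a ∧ b) ≡ boolToℕ a
boolToℕ-∧-true a refl = cong boolToℕ (𝔹.∧-identityʳ a)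

count-∧≤count : ∀ {n} (L x : Fin n → Bool) → count (λ u → L u ∧ x u) ≤ count x
count-∧≤count L x = sum-mono λ u → ∧-bit≤ (L u) (x u)
  where
  ∧-bit≤ : ∀ a b → boolToℕ (a ∧ b) ≤ boolToℕ b
  ∧-bit≤ false b = z≤n
  ∧-bit≤ true  b = ℕ.≤-refl

module _ {n} (L : Fin n → Bool) where

  fK-cong : ∀ {x y} → x ≗ y → fK L x ≡ fK L y
  fK-cong x≗y = cong₂ (λ c d → oddChoose2 c xor odd d)
    (sum-cong-≗ (cong boolToℕ ∘ x≗y)) (sum-cong-≗ λ u → cong (λ b → boolToℕ (L u ∧ b)) (x≗y u))

  fK-zero : ∀ {x} → (∀ u → x u ≡ false) → fK L x ≡ false
  fK-zero {x} x≡0 = cong₂ (λ c d → oddChoose2 c xor odd d)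
    (sum-zero (cong boolToℕ ∘ x≡0)) (sum-zero λ u → boolToℕ-∧-false (L u) (x≡0 u))

  fK-single : ∀ {x p} → x p ≡ true → (∀ u → u ≢ p → x u ≡ false) → fK L x ≡ L p
  fK-single {x} {p} xp≡ x≡0 = begin
    fK L x                                    ≡⟨ cong₂ (λ c d → oddChoose2 c xor odd d) size looped ⟩
    oddChoose2 1 xor odd (boolToℕ (L p))      ≡⟨ odd-boolToℕ (L p) ⟩
    L p                                       ∎
    where
    size : count x ≡ 1
    size = trans (sum-point p (λ u u≢p → cong boolToℕ (x≡0 u u≢p))) (cong boolToℕ xp≡)
    looped : count (λ u → L u ∧ x u) ≡ boolToℕ (L p)
    looped = trans (sum-point p (λ u u≢p → boolToℕ-∧-false (L u) (x≡0 u u≢p))) (boolToℕ-∧-true (L p) xp≡)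

  fK-pair : ∀ {x p q} → p ≢ q → x p ≡ true → x q ≡ true → (∀ u → u ≢ p → u ≢ q → x u ≡ false) →
            fK L x ≡ not (L p xor L q)
  fK-pair {x} {p} {q} p≢q xp≡ xq≡ x≡0 = begin
    fK L x                                                   ≡⟨ cong₂ (λ c d → oddChoose2 c xor odd d) size looped ⟩
    oddChoose2 2 xor odd (boolToℕ (L p) + boolToℕ (L q))     ≡⟨ cong not (odd-sum (L p) (L q)) ⟩
    not (L p xor L q)                                        ∎
    where
    size : count x ≡ 2
    size = trans (sum-pair p≢q (λ u u≢p u≢q → cong boolToℕ (x≡0 u u≢p u≢q)))
                 (cong₂ _+_ (cong boolToℕ xp≡) (cong boolToℕ xq≡))
    looped : count (λ u → L u ∧ x u) ≡ boolToℕ (L p) + boolToℕ (L q)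
    looped = trans (sum-pair p≢q (λ u u≢p u≢q → boolToℕ-∧-false (L u) (x≡0 u u≢p u≢q)))
                   (cong₂ _+_ (boolToℕ-∧-true (L p) xp≡) (boolToℕ-∧-true (L q) xq≡))
    odd-sum : ∀ a b → odd (boolToℕ a + boolToℕ b) ≡ a xor b
    odd-sum false b = odd-boolToℕ b
    odd-sum true  b = cong not (odd-boolToℕ b)

  fK-weight-1 : ∀ {x} → count x ≡ 1 → boolToℕ (fK L x) ≡ count (λ u → L u ∧ x u)
  fK-weight-1 {x} size = trans (cong (λ c → boolToℕ (oddChoose2 c xor odd looped)) size)
                               (boolToℕ-odd (subst (looped ≤_) size (count-∧≤count L x)))
    where
    looped = count (λ u → L u ∧ x u)
    boolToℕ-odd : ∀ {w} → w ≤ 1 → boolToℕ (odd w) ≡ w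
    boolToℕ-odd z≤n       = refl
    boolToℕ-odd (s≤s z≤n) = refl

  fK-permute : (π : Permutation n n) → (∀ u → L (π ⟨$⟩ʳ u) ≡ L u) →
               ∀ x → fK L (x ∘ (π ⟨$⟩ʳ_)) ≡ fK L x
  fK-permute π L∘π≗L x = cong₂ (λ c d → oddChoose2 c xor odd d)
    (sym (sum-permute (boolToℕ ∘ x) π))
    (trans (sum-cong-≗ λ u → cong (λ b → boolToℕ (b ∧ x (π ⟨$⟩ʳ u))) (sym (L∘π≗L u)))
           (sym (sum-permute (λ u → boolToℕ (L u ∧ x u)) π)))

  -- On inputs with x p = x q, a loop at exactly one of p, q makes the common value irrelevant:
  -- raising it from 0 to 1 adds 2 to the weight and 1 to the number of loops hit, and both
  -- flip the parity.
  fK-mixed-pair : ∀ {p q x y} → p ≢ q → L q ≡ not (L p) → x p ≡ x q → y p ≡ y q →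
                  (∀ u → u ≢ p → u ≢ q → x u ≡ y u) → fK L x ≡ fK L y
  fK-mixed-pair {p} {q} {x} {y} p≢q Lq≡ xp≡xq yp≡yq agree =
    compare (x p) (y p) {count x} {count y} weights looped
    where
    weights : count x + (boolToℕ (y p) + boolToℕ (y p)) ≡ count y + (boolToℕ (x p) + boolToℕ (x p))
    weights = subst₂ (λ b b′ → count x + (boolToℕ (y p) + boolToℕ b) ≡ count y + (boolToℕ (x p) + boolToℕ b′))
                (sym yp≡yq) (sym xp≡xq) (sum-exchange₂ p≢q (λ u u≢p u≢q → cong boolToℕ (agree u u≢p u≢q)))
    split : ∀ s t → boolToℕ (s ∧ t) + boolToℕ (not s ∧ t) ≡ boolToℕ t
    split false t = refl
    split true  t = ℕ.+-identityʳ (boolToℕ t)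
    loops-at : ∀ z → z p ≡ z q → boolToℕ (L p ∧ z p) + boolToℕ (L q ∧ z q) ≡ boolToℕ (z p)
    loops-at z zp≡zq = trans (cong₂ (λ s t → boolToℕ (L p ∧ z p) + boolToℕ (s ∧ t)) Lq≡ (sym zp≡zq)) (split (L p) (z p))
    looped : count (λ u → L u ∧ x u) + boolToℕ (y p) ≡ count (λ u → L u ∧ y u) + boolToℕ (x p)
    looped = subst₂ (λ a b → count (λ u → L u ∧ x u) + a ≡ count (λ u → L u ∧ y u) + b)
               (loops-at y yp≡yq) (loops-at x xp≡xq)
               (sum-exchange₂ p≢q (λ u u≢p u≢q → cong (λ b → boolToℕ (L u ∧ b)) (agree u u≢p u≢q)))
    flip-flip : ∀ a b d → ((a xor b) xor not b) xor not d ≡ a xor d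
    flip-flip false false false = refl
    flip-flip false false true  = refl
    flip-flip false true  false = refl
    flip-flip false true  true  = refl
    flip-flip true  false false = refl
    flip-flip true  false true  = refl
    flip-flip true  true  false = refl
    flip-flip true  true  true  = refl
    raise : ∀ {c c′ l l′} → c + 0 ≡ c′ + 2 → l + 0 ≡ l′ + 1 → oddChoose2 c xor odd l ≡ oddChoose2 c′ xor odd l′
    raise {c′ = c′} {l′ = l′} c≡ l≡
      rewrite trans (sym (ℕ.+-identityʳ _)) (trans c≡ (ℕ.+-comm c′ 2))
            | trans (sym (ℕ.+-identityʳ _)) (trans l≡ (ℕ.+-comm l′ 1))
      = flip-flip (oddChoose2 c′) (odd c′) (odd l′)
    compare : ∀ t t′ {c c′ l l′} → c + (boolToℕ t′ + boolToℕ t′) ≡ c′ + (boolToℕ t + boolToℕ t) →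
              l + boolToℕ t′ ≡ l′ + boolToℕ t → oddChoose2 c xor odd l ≡ oddChoose2 c′ xor odd l′
    compare false false c≡ l≡ = cong₂ (λ c l → oddChoose2 c xor odd l) (ℕ.+-cancelʳ-≡ 0 _ _ c≡) (ℕ.+-cancelʳ-≡ 0 _ _ l≡)
    compare true  true  c≡ l≡ = cong₂ (λ c l → oddChoose2 c xor odd l) (ℕ.+-cancelʳ-≡ 2 _ _ c≡) (ℕ.+-cancelʳ-≡ 1 _ _ l≡)
    compare true  false c≡ l≡ = raise c≡ l≡
    compare false true  c≡ l≡ = sym (raise (sym c≡) (sym l≡))

-- Minors of Boolean functions

Extensional : ∀ {n} → ((Fin n → Bool) → Bool) → Set
Extensional f = ∀ {x y} → x ≗ y → f x ≡ f y

minor : ∀ {n k} → ((Fin n → Bool) → Bool) → (Fin n → Fin k) → BFun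
minor {k = k} f σ = k , λ α → f (α ∘ σ)

minor-extensional : ∀ {n k} {f : (Fin n → Bool) → Bool} → Extensional f → (σ : Fin n → Fin k) →
                    Extensional (proj₂ (minor f σ))
minor-extensional f-ext σ α≗β = f-ext (α≗β ∘ σ)

≼-trans : ∀ {f g h} → f ≼ g → g ≼ h → f ≼ h
≼-trans {_ , f} {_ , g} {_ , h} (σ , f≡g∘σ) (τ , g≡h∘τ) = σ ∘ τ , λ a → trans (f≡g∘σ a) (g≡h∘τ (a ∘ σ))

≼-respˡ-≗ : ∀ {k} {f g : (Fin k → Bool) → Bool} {h} → f ≗ g → (k , g) ≼ h → (k , f) ≼ h
≼-respˡ-≗ {h = _ , _} f≗g (σ , g≡h∘σ) = σ , λ a → trans (f≗g a) (g≡h∘σ a)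

≼-respʳ-≗ : ∀ {k} {f g : (Fin k → Bool) → Bool} {h} → f ≗ g → h ≼ (k , f) → h ≼ (k , g)
≼-respʳ-≗ {h = _ , _} f≗g (σ , h≡f∘σ) = σ , λ a → trans (h≡f∘σ a) (f≗g (a ∘ σ))

joinIrreducible-resp-≗ : ∀ {k} {f g : (Fin k → Bool) → Bool} → f ≗ g → JoinIrreducible (k , f) → JoinIrreducible (k , g)
joinIrreducible-resp-≗ {k} {f} {g} f≗g (top , (top≼f , f⋠top) , below-top) =
  top , (≼-respʳ-≗ {h = top} f≗g top≼f , f⋠top ∘ ≼-respˡ-≗ {h = top} f≗g) ,
  λ h (h≼g , g⋠h) → below-top h (≼-respʳ-≗ {h = h} (sym ∘ f≗g) h≼g , g⋠h ∘ ≼-respˡ-≗ {h = h} (sym ∘ f≗g))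

Essential : ∀ {n} → ((Fin n → Bool) → Bool) → Fin n → Set
Essential f v = ∃₂ λ a a′ → (∀ w → w ≢ v → a w ≡ a′ w) × f a ≢ f a′

essential⇒hit : ∀ {n k} {f : (Fin n → Bool) → Bool} {g : (Fin k → Bool) → Bool} → Extensional f →
                ∀ σ → (∀ a → g a ≡ f (a ∘ σ)) → ∀ {v} → Essential g v → ∃ λ u → σ u ≡ v
essential⇒hit f-ext σ g≡f∘σ {v} (a , a′ , agree , ga≢ga′) with any? (λ u → σ u ≟ v)
... | yes hit = hit
... | no  miss = contradiction
      (trans (g≡f∘σ a) (trans (f-ext λ u → agree (σ u) λ σu≡v → miss (u , σu≡v)) (sym (g≡f∘σ a′)))) ga≢ga′

Collision : ∀ {n k} → (Fin n → Fin k) → Set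
Collision σ = ∃₂ λ i j → i ≢ j × σ i ≡ σ j

collision-or-injective : ∀ {n k} (σ : Fin n → Fin k) → Collision σ ⊎ Injective _≡_ _≡_ σ
collision-or-injective σ with any? (λ i → any? (λ j → ¬? (i ≟ j) ×-dec (σ i ≟ σ j)))
... | yes (i , j , collide) = inj₁ (i , j , collide)
... | no  none = inj₂ λ {i} {j} σi≡σj → decidable-stable (i ≟ j) λ i≢j → none (i , j , i≢j , σi≡σj)

injective⇒≽minor : ∀ {m k} {f : (Fin (suc m) → Bool) → Bool} → Extensional f → (σ : Fin (suc m) → Fin k) →
                   Injective _≡_ _≡_ σ → (suc m , f) ≼ minor f σ
injective⇒≽minor {f = f} f-ext σ σ-inj = retract , λ a → f-ext λ u → cong a (sym (retract-σ u))
  where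
  retract : Fin _ → Fin (suc _)
  retract v with any? (λ u → σ u ≟ v)
  ... | yes (u , _) = u
  ... | no  _       = zero
  retract-σ : ∀ u → retract (σ u) ≡ u
  retract-σ u with any? (λ u′ → σ u′ ≟ σ u)
  ... | yes (u′ , σu′≡σu) = σ-inj σu′≡σu
  ... | no  miss          = contradiction (u , refl) miss

-- merge a b sends b to the image of a and relabels Fin (suc m) ∖ {b} order-preservingly as Fin m.
merge : ∀ {m} (a b : Fin (suc m)) → a ≢ b → Fin (suc m) → Fin m
merge a b a≢b u with b ≟ u
... | yes _   = punchOut (a≢b ∘ sym)
... | no  b≢u = punchOut b≢u

module _ {m} {a b : Fin (suc m)} (a≢b : a ≢ b) where

  merge-punchIn : ∀ v → merge a b a≢b (punchIn b v) ≡ v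
  merge-punchIn v with b ≟ punchIn b v
  ... | yes b≡ = contradiction (sym b≡) (punchInᵢ≢i b v)
  ... | no  b≢ = trans (punchOut-cong b refl) (punchOut-punchIn b)

  punchIn-merge : ∀ {u} → u ≢ b → punchIn b (merge a b a≢b u) ≡ u
  punchIn-merge {u} u≢b with b ≟ u
  ... | yes b≡u = contradiction (sym b≡u) u≢b
  ... | no  b≢u = punchIn-punchOut b≢u

  punchIn-merge-b : punchIn b (merge a b a≢b b) ≡ a
  punchIn-merge-b with b ≟ b
  ... | yes _   = punchIn-punchOut (a≢b ∘ sym)
  ... | no  b≢b = contradiction refl b≢b

  merge-identifies : merge a b a≢b a ≡ merge a b a≢b b
  merge-identifies = begin
    merge a b a≢b a                                ≡⟨ cong (merge a b a≢b) punchIn-merge-b ⟨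
    merge a b a≢b (punchIn b (merge a b a≢b b))    ≡⟨ merge-punchIn _ ⟩
    merge a b a≢b b                                ∎

  merge-fibre : ∀ {u v} → merge a b a≢b u ≡ v → u ≡ punchIn b v ⊎ u ≡ b
  merge-fibre {u} refl with u ≟ b
  ... | yes u≡b = inj₂ u≡b
  ... | no  u≢b = inj₁ (sym (punchIn-merge u≢b))

  factor-through-merge : ∀ {k} (σ : Fin (suc m) → Fin k) → σ a ≡ σ b → ∀ u → σ u ≡ σ (punchIn b (merge a b a≢b u))
  factor-through-merge σ σa≡σb u with u ≟ b
  ... | yes refl = trans (sym σa≡σb) (cong σ (sym punchIn-merge-b))
  ... | no  u≢b  = cong σ (sym (punchIn-merge u≢b))

identify : ∀ {m} → ((Fin (suc m) → Bool) → Bool) → (a b : Fin (suc m)) → a ≢ b → BFun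
identify f a b a≢b = minor f (merge a b a≢b)

module _ {m} {f : (Fin (suc m) → Bool) → Bool} (f-ext : Extensional f) {a b : Fin (suc m)} (a≢b : a ≢ b) where

  collision⇒≼identify : ∀ {k} (σ : Fin (suc m) → Fin k) → σ a ≡ σ b → minor f σ ≼ identify f a b a≢b
  collision⇒≼identify σ σa≡σb = σ ∘ punchIn b , λ α → f-ext λ u → cong α (factor-through-merge a≢b σ σa≡σb u)

  identify-≺ : (∀ v → Essential f v) → identify f a b a≢b ≺ (suc m , f)
  identify-≺ essential = (merge a b a≢b , λ _ → refl) , not-above
    where
    not-above : ¬ ((suc m , f) ≼ identify f a b a≢b)
    not-above (σ , f≡) =
      let i , j , i<j , same = pigeonhole (ℕ.n<1+n m) (proj₁ ∘ hit)
      in <⇒≢ i<j (trans (sym (proj₂ (hit i))) (trans (cong σ same) (proj₂ (hit j))))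
      where
      hit : ∀ v → ∃ λ u → σ u ≡ v
      hit v = essential⇒hit (minor-extensional f-ext (merge a b a≢b)) σ f≡ (essential v)

  -- Every g ≺ f is a minor along a non-injective substitution, as an injective one gives f ≼ g.
  identification-top⇒joinIrreducible :
    (∀ v → Essential f v) →
    (∀ {k} (σ : Fin (suc m) → Fin k) {i j} → i ≢ j → σ i ≡ σ j → minor f σ ≼ identify f a b a≢b) →
    JoinIrreducible (suc m , f)
  identification-top⇒joinIrreducible essential top = identify f a b a≢b , identify-≺ essential , below
    where
    below : ∀ g → g ≺ (suc m , f) → g ≼ identify f a b a≢b
    below (k , g) ((σ , g≡f∘σ) , f⋠g) with collision-or-injective σ
    ... | inj₁ (i , j , i≢j , σi≡σj) = ≼-trans {k , g} {minor f σ} {identify f a b a≢b} ((λ v → v) , g≡f∘σ) (top σ i≢j σi≡σj)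
    ... | inj₂ σ-inj = contradiction (≼-respʳ-≗ {h = suc m , f} (sym ∘ g≡f∘σ) (injective⇒≽minor f-ext σ σ-inj)) f⋠g

δ : ∀ {n} → Fin n → Fin n → Bool
δ v w = does (w ≟ v)

δ-same : ∀ {n} (v : Fin n) → δ v v ≡ true
δ-same v = dec-true (v ≟ v) refl

δ-other : ∀ {n} {v w : Fin n} → w ≢ v → δ v w ≡ false
δ-other {v = v} {w} = dec-false (w ≟ v)

module _ {k} {g : (Fin k → Bool) → Bool} where

  essential-by-unit : ∀ v → g (const false) ≢ g (δ v) → Essential g v
  essential-by-unit v differ = const false , δ v , (λ w w≢v → sym (δ-other w≢v)) , differ

  essential-by-pair : ∀ v w → g (δ w) ≢ g (λ u → δ w u ∨ δ v u) → Essential g v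
  essential-by-pair v w differ = δ w , (λ u → δ w u ∨ δ v u) ,
    (λ u u≢v → trans (sym (𝔹.∨-identityʳ (δ w u))) (cong (δ w u ∨_) (sym (δ-other u≢v)))) , differ

fK-essential : ∀ {m} (L : Fin (suc (suc m)) → Bool) → ∀ v → Essential (fK L) v
fK-essential L v with L v in Lv≡
... | true  = essential-by-unit v λ same →
      contradiction (trans (sym (fK-zero L λ _ → refl)) (trans same (trans (fK-single L (δ-same v) λ _ → δ-other) Lv≡))) λ ()
... | false = essential-by-pair v w λ same → 𝔹.not-¬ refl (begin
      L w                        ≡⟨ fK-single L (δ-same w) (λ _ → δ-other) ⟨
      fK L (δ w)                 ≡⟨ same ⟩
      fK L (λ u → δ w u ∨ δ v u) ≡⟨ fK-pair L w≢v (cong (_∨ δ v w) (δ-same w))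
                                      (trans (cong (δ w v ∨_) (δ-same v)) (𝔹.∨-zeroʳ (δ w v))) outside ⟩
      not (L w xor L v)          ≡⟨ cong (λ b → not (L w xor b)) Lv≡ ⟩
      not (L w xor false)        ≡⟨ cong not (𝔹.xor-identityʳ (L w)) ⟩
      not (L w)                  ∎)
  where
  w = punchIn v zero
  w≢v : w ≢ v
  w≢v = punchInᵢ≢i v zero
  outside : ∀ u → u ≢ w → u ≢ v → δ w u ∨ δ v u ≡ false
  outside u u≢w u≢v rewrite δ-other u≢w | δ-other u≢v = refl

-- Join-irreducibility when at most one vertex differs from the others

module _ {n} (i j : Fin n) where

  transpose-left : transpose i j ⟨$⟩ʳ i ≡ j
  transpose-left rewrite dec-true (i ≟ i) refl = refl

  transpose-right : transpose i j ⟨$⟩ʳ j ≡ i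
  transpose-right with i ≟ j
  ... | yes refl = transpose-left
  ... | no  i≢j  rewrite dec-false (j ≟ i) (i≢j ∘ sym) | dec-true (j ≟ j) refl = refl

  transpose-other : ∀ {k} → k ≢ i → k ≢ j → transpose i j ⟨$⟩ʳ k ≡ k
  transpose-other {k} k≢i k≢j rewrite dec-false (k ≟ i) k≢i | dec-false (k ≟ j) k≢j = refl

  transpose-preserves : ∀ {A : Set} (L : Fin n → A) → L i ≡ L j → ∀ k → L (transpose i j ⟨$⟩ʳ k) ≡ L k
  transpose-preserves L Li≡Lj k = by-cases (k ≟ i) (k ≟ j)
    where
    by-cases : Dec (k ≡ i) → Dec (k ≡ j) → L (transpose i j ⟨$⟩ʳ k) ≡ L k
    by-cases (yes k≡i) _ = trans (cong (λ t → L (transpose i j ⟨$⟩ʳ t)) k≡i)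
                                 (trans (cong L transpose-left) (sym (trans (cong L k≡i) Li≡Lj)))
    by-cases (no _) (yes k≡j) = trans (cong (λ t → L (transpose i j ⟨$⟩ʳ t)) k≡j)
                                      (trans (cong L transpose-right) (trans Li≡Lj (sym (cong L k≡j))))
    by-cases (no k≢i) (no k≢j) = cong L (transpose-other k≢i k≢j)

module _ {m} (L : Fin (suc (suc m)) → Bool) where

  minor-transpose : ∀ {k} (σ : Fin (suc (suc m)) → Fin k) {p q} → L p ≡ L q →
                    proj₂ (minor (fK L) σ) ≗ proj₂ (minor (fK L) (σ ∘ (transpose p q ⟨$⟩ʳ_)))
  minor-transpose σ {p} {q} Lp≡Lq α = sym (fK-permute L (transpose p q) (transpose-preserves p q L Lp≡Lq) (α ∘ σ))

  same-type-collision : ∀ {k} (σ : Fin (suc (suc m)) → Fin k) {i j a b} (a≢b : a ≢ b) → i ≢ j → σ i ≡ σ j →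
                        L a ≡ L i → L b ≡ L j → minor (fK L) σ ≼ identify (fK L) a b a≢b
  same-type-collision σ {i} {j} {a} {b} a≢b i≢j σi≡σj La≡Li Lb≡Lj =
    ≼-respˡ-≗ {h = identify (fK L) a b a≢b}
      (λ α → trans (minor-transpose σ La≡Li α) (minor-transpose (σ ∘ (τ₁ ⟨$⟩ʳ_)) Lb≡Lj′ α))
      (collision⇒≼identify (fK-cong L) a≢b σ′ σ′a≡σ′b)
    where
    τ₁ = transpose a i
    j′ = τ₁ ⟨$⟩ˡ j
    τ₁j′≡j : τ₁ ⟨$⟩ʳ j′ ≡ j
    τ₁j′≡j = Perm.inverseʳ τ₁
    a≢j′ : a ≢ j′
    a≢j′ a≡j′ = i≢j (trans (sym (transpose-left a i)) (trans (cong (τ₁ ⟨$⟩ʳ_) a≡j′) τ₁j′≡j))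
    Lb≡Lj′ : L b ≡ L j′
    Lb≡Lj′ = trans Lb≡Lj (trans (cong L (sym τ₁j′≡j)) (transpose-preserves a i L La≡Li j′))
    τ₂ = transpose b j′
    σ′ = σ ∘ (τ₁ ⟨$⟩ʳ_) ∘ (τ₂ ⟨$⟩ʳ_)
    σ′a≡σ′b : σ′ a ≡ σ′ b
    σ′a≡σ′b = begin
      σ (τ₁ ⟨$⟩ʳ (τ₂ ⟨$⟩ʳ a))  ≡⟨ cong (σ ∘ (τ₁ ⟨$⟩ʳ_)) (transpose-other b j′ a≢b a≢j′) ⟩
      σ (τ₁ ⟨$⟩ʳ a)            ≡⟨ cong σ (transpose-left a i) ⟩
      σ i                      ≡⟨ σi≡σj ⟩
      σ j                      ≡⟨ cong σ τ₁j′≡j ⟨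
      σ (τ₁ ⟨$⟩ʳ j′)           ≡⟨ cong (σ ∘ (τ₁ ⟨$⟩ʳ_)) (transpose-left b j′) ⟨
      σ (τ₁ ⟨$⟩ʳ (τ₂ ⟨$⟩ʳ b))  ∎

  mixed-collision : ∀ {k} (σ : Fin (suc (suc m)) → Fin k) {p q c} (c≢p : c ≢ p) → σ p ≡ σ q →
                    L q ≡ not (L p) → L c ≡ L p → minor (fK L) σ ≼ identify (fK L) p c (c≢p ∘ sym)
  mixed-collision σ {p} {q} {c} c≢p σp≡σq Lq≡ Lc≡Lp =
    ≼-respˡ-≗ {h = identify (fK L) p c (c≢p ∘ sym)}
      (λ α → fK-mixed-pair L p≢q Lq≡ (cong α σp≡σq) (cong α (trans φp≡σc (sym φq≡σc)))
                 λ u u≢p u≢q → cong α (sym (φ-other u≢p u≢q)))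
      (collision⇒≼identify (fK-cong L) (c≢p ∘ sym) φ (trans φp≡σc (sym (φ-other c≢p c≢q))))
    where
    self-negation : L p ≢ not (L p)
    self-negation = 𝔹.not-¬ refl
    p≢q : p ≢ q
    p≢q p≡q = self-negation (trans (cong L p≡q) Lq≡)
    c≢q : c ≢ q
    c≢q c≡q = self-negation (trans (sym Lc≡Lp) (trans (cong L c≡q) Lq≡))
    φ′ = updateAt σ p (const (σ c))
    φ  = updateAt φ′ q (const (σ c))
    φq≡σc : φ q ≡ σ c
    φq≡σc = updateAt-updates q φ′
    φp≡σc : φ p ≡ σ c
    φp≡σc = trans (updateAt-minimal p q φ′ p≢q) (updateAt-updates p σ)
    φ-other : ∀ {u} → u ≢ p → u ≢ q → φ u ≡ σ u
    φ-other {u} u≢p u≢q = trans (updateAt-minimal u q φ′ u≢q) (updateAt-minimal u p σ u≢p)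

  fK-joinIrreducible : (s : Bool) {a b : Fin (suc (suc m))} (a≢b : a ≢ b) → L a ≡ s → L b ≡ s →
                       (∀ {i j} → L i ≡ not s → L j ≡ not s → i ≡ j) → JoinIrreducible (suc (suc m) , fK L)
  fK-joinIrreducible s {a} {b} a≢b La≡s Lb≡s minority-unique =
    identification-top⇒joinIrreducible (fK-cong L) a≢b (fK-essential L) top
    where
    another : ∀ p → ∃ λ c → c ≢ p × L c ≡ s
    another p with p ≟ a
    ... | yes refl = b , a≢b ∘ sym , Lb≡s
    ... | no  p≢a  = a , p≢a ∘ sym , La≡s
    mixed : ∀ {k} (σ : Fin (suc (suc m)) → Fin k) {p q} → σ p ≡ σ q → L p ≡ s → L q ≡ not s →
            minor (fK L) σ ≼ identify (fK L) a b a≢b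
    mixed σ {p} σp≡σq Lp≡s Lq≡ with another p
    ... | c , c≢p , Lc≡s =
      ≼-trans {minor (fK L) σ} {identify (fK L) p c (c≢p ∘ sym)} {identify (fK L) a b a≢b}
        (mixed-collision σ c≢p σp≡σq (trans Lq≡ (cong not (sym Lp≡s))) (trans Lc≡s (sym Lp≡s)))
        (same-type-collision (merge p c (c≢p ∘ sym)) a≢b (c≢p ∘ sym) (merge-identifies (c≢p ∘ sym))
           (trans La≡s (sym Lp≡s)) (trans Lb≡s (sym Lc≡s)))
    top : ∀ {k} (σ : Fin (suc (suc m)) → Fin k) {i j} → i ≢ j → σ i ≡ σ j → minor (fK L) σ ≼ identify (fK L) a b a≢b
    top σ {i} {j} i≢j σi≡σj with L i 𝔹.≟ s | L j 𝔹.≟ s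
    ... | yes Li≡s | yes Lj≡s = same-type-collision σ a≢b i≢j σi≡σj (trans La≡s (sym Li≡s)) (trans Lb≡s (sym Lj≡s))
    ... | yes Li≡s | no  Lj≢s = mixed σ σi≡σj Li≡s (𝔹.¬-not Lj≢s)
    ... | no  Li≢s | yes Lj≡s = mixed σ (sym σi≡σj) Lj≡s (𝔹.¬-not Li≢s)
    ... | no  Li≢s | no  Lj≢s = contradiction (minority-unique (𝔹.¬-not Li≢s) (𝔹.¬-not Lj≢s)) i≢j

fK-joinIrreducible₂ : (L : Fin 2 → Bool) → JoinIrreducible (2 , fK L)
fK-joinIrreducible₂ L = identification-top⇒joinIrreducible (fK-cong L) 0≢1 (fK-essential L) top
  where
  0≢1 : zero ≢ suc zero
  0≢1 ()
  top : ∀ {k} (σ : Fin 2 → Fin k) {i j} → i ≢ j → σ i ≡ σ j → minor (fK L) σ ≼ identify (fK L) zero (suc zero) 0≢1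
  top σ {zero}     {zero}     i≢j _     = contradiction refl i≢j
  top σ {zero}     {suc zero} _   σi≡σj = collision⇒≼identify (fK-cong L) 0≢1 σ σi≡σj
  top σ {suc zero} {zero}     _   σi≡σj = collision⇒≼identify (fK-cong L) 0≢1 σ (sym σi≡σj)
  top σ {suc zero} {suc zero} i≢j _     = contradiction refl i≢j

-- Non-join-irreducibility with two loops and two non-loops

third : ∀ {m} {v w : Fin (suc (suc (suc m)))} → v ≢ w → ∃ λ t → t ≢ v × t ≢ w
third {v = v} {w} v≢w = punchIn w t′ , t≢v , punchInᵢ≢i w t′
  where
  v′ = punchOut (v≢w ∘ sym)
  t′ = punchIn v′ zero
  t≢v : punchIn w t′ ≢ v
  t≢v t≡v = punchInᵢ≢i v′ zero (punchIn-injective w t′ v′ (trans t≡v (sym (punchIn-punchOut (v≢w ∘ sym)))))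

module _ {m} (L : Fin (suc (suc (suc (suc m)))) → Bool) {a b : Fin (suc (suc (suc (suc m))))} (a≢b : a ≢ b) where

  private
    μ = merge a b a≢b

  merged-fibre-pair : ∀ {u} → u ≢ a → u ≢ b → μ u ≢ μ a
  merged-fibre-pair {u} u≢a u≢b μu≡μa with merge-fibre a≢b μu≡μa
  ... | inj₁ u≡ = u≢a (trans u≡ (punchIn-merge a≢b a≢b))
  ... | inj₂ u≡b = u≢b u≡b

  merged-fibre-single : ∀ {v u} → v ≢ μ a → u ≢ punchIn b v → μ u ≢ v
  merged-fibre-single {v} v≢μa u≢ μu≡v with merge-fibre a≢b μu≡v
  ... | inj₁ u≡ = u≢ u≡
  ... | inj₂ refl = v≢μa (trans (sym μu≡v) (sym (merge-identifies a≢b)))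

  merged-unit : ∀ {v} → v ≢ μ a → fK L (δ v ∘ μ) ≡ L (punchIn b v)
  merged-unit {v} v≢μa = fK-single L (trans (cong (δ v) (merge-punchIn a≢b v)) (δ-same v))
                                     (λ _ u≢ → δ-other (merged-fibre-single v≢μa u≢))

  unmerged-essential : ∀ {v} → v ≢ μ a → Essential (proj₂ (identify (fK L) a b a≢b)) v
  unmerged-essential {v} v≢μa with L (punchIn b v) in Lu≡
  ... | true  = essential-by-unit v λ same → contradiction
        (trans (sym (fK-zero L λ _ → refl)) (trans same (trans (merged-unit v≢μa) Lu≡))) λ ()
  ... | false = essential-by-pair v t λ same → 𝔹.not-¬ refl (begin
        L w                                  ≡⟨ merged-unit t≢μa ⟨
        fK L (δ t ∘ μ)                       ≡⟨ same ⟩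
        fK L (λ u → δ t (μ u) ∨ δ v (μ u))   ≡⟨ fK-pair L w≢u at-w at-u outside ⟩
        not (L w xor L (punchIn b v))        ≡⟨ cong (λ c → not (L w xor c)) Lu≡ ⟩
        not (L w xor false)                  ≡⟨ cong not (𝔹.xor-identityʳ (L w)) ⟩
        not (L w)                            ∎)
    where
    t  = proj₁ (third v≢μa)
    t≢v = proj₁ (proj₂ (third v≢μa))
    t≢μa = proj₂ (proj₂ (third v≢μa))
    w = punchIn b t
    w≢u : w ≢ punchIn b v
    w≢u = t≢v ∘ punchIn-injective b t v
    at-w : δ t (μ w) ∨ δ v (μ w) ≡ true
    at-w rewrite merge-punchIn a≢b t | δ-same t = refl
    at-u : δ t (μ (punchIn b v)) ∨ δ v (μ (punchIn b v)) ≡ true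
    at-u rewrite merge-punchIn a≢b v | δ-same v = 𝔹.∨-zeroʳ (δ t v)
    outside : ∀ u → u ≢ w → u ≢ punchIn b v → δ t (μ u) ∨ δ v (μ u) ≡ false
    outside u u≢w u≢ rewrite δ-other (merged-fibre-single t≢μa u≢w) | δ-other (merged-fibre-single v≢μa u≢) = refl

  identify-essential : L a ≡ L b → ∀ v → Essential (proj₂ (identify (fK L) a b a≢b)) v
  identify-essential La≡Lb v with v ≟ μ a
  ... | no  v≢μa = unmerged-essential v≢μa
  ... | yes refl = essential-by-unit v λ same → contradiction (begin
        false                          ≡⟨ fK-zero L (λ _ → refl) ⟨
        fK L (const false)             ≡⟨ same ⟩
        fK L (δ v ∘ μ)                 ≡⟨ fK-pair L a≢b (δ-same v) (trans (cong (δ v) (sym (merge-identifies a≢b))) (δ-same v))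
                                                    (λ u u≢a u≢b → δ-other (merged-fibre-pair u≢a u≢b)) ⟩
        not (L a xor L b)              ≡⟨ cong (λ c → not (L a xor c)) La≡Lb ⟨
        not (L a xor L a)              ≡⟨ cong not (𝔹.xor-same (L a)) ⟩
        true                           ∎) λ ()

unitWeight : BFun → ℕ
unitWeight (k , g) = sum (λ v → boolToℕ (g (δ v)))

sum-over-fibres : ∀ {n k} (ψ : Fin n → Fin k) (x : Fin n → Bool) →
                  sum (λ v → count (λ u → x u ∧ δ v (ψ u))) ≡ count x
sum-over-fibres ψ x = trans (∑-comm (λ v u → boolToℕ (x u ∧ δ v (ψ u)))) (sum-cong-≗ λ u →
  trans (sum-point (ψ u) (λ v v≢ψu → boolToℕ-∧-false (x u) (δ-other (v≢ψu ∘ sym))))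
        (boolToℕ-∧-true (x u) (δ-same (ψ u))))

-- {i, j} is the only fibre of ψ with more than one element; on a singleton fibre fK reads off
-- its loop, on {i, j} it gives 1 + L i + L j (mod 2).
module _ {M} (L : Fin (suc (suc M)) → Bool) (ψ : Fin (suc (suc M)) → Fin (suc M))
         (ψ-onto : ∀ v → ∃ λ u → ψ u ≡ v) {i j} (i≢j : i ≢ j) (ψi≡ψj : ψ i ≡ ψ j) where

  private
    fibre : Fin (suc M) → Fin (suc (suc M)) → Bool
    fibre v u = δ v (ψ u)
    v₀ = ψ i
    fibre-i : fibre v₀ i ≡ true
    fibre-i = δ-same v₀
    fibre-j : fibre v₀ j ≡ true
    fibre-j = trans (cong (δ v₀) (sym ψi≡ψj)) (δ-same v₀)
    minimal : Fin (suc M) → ℕ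
    minimal = updateAt (const 1) v₀ (const 2)

  fibre-sizes : ∀ v → count (fibre v) ≡ minimal v
  fibre-sizes = sum-mono-tight minimal≤size (trans total (sym minimal-total))
    where
    minimal≤size : ∀ v → minimal v ≤ count (fibre v)
    minimal≤size v with v ≟ v₀
    ... | yes refl = subst (_≤ count (fibre v₀)) (sym (updateAt-updates v₀ (const 1)))
                           (two⇒count≥2 (fibre v₀) i≢j fibre-i fibre-j)
    ... | no  v≢v₀ = let u , ψu≡v = ψ-onto v in
      subst₂ _≤_ (sym (updateAt-minimal v v₀ (const 1) v≢v₀)) refl
        (subst (λ b → boolToℕ b ≤ count (fibre v)) (trans (cong (δ v) ψu≡v) (δ-same v)) (term≤sum u (boolToℕ ∘ fibre v)))
    total : sum (λ v → count (fibre v)) ≡ suc (suc M)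
    total = trans (sum-over-fibres ψ (const true)) (sum-const-1 (suc (suc M)))
    minimal-total : sum minimal ≡ suc (suc M)
    minimal-total = ℕ.+-cancelʳ-≡ 1 _ _ (begin
      sum minimal + 1                     ≡⟨ sum-exchange v₀ (λ v v≢v₀ → updateAt-minimal v v₀ (const 1) v≢v₀) ⟩
      sum {suc M} (const 1) + minimal v₀  ≡⟨ cong₂ _+_ (sum-const-1 (suc M)) (updateAt-updates v₀ (const 1)) ⟩
      suc M + 2                           ≡⟨ ℕ.+-suc (suc M) 1 ⟩
      suc (suc M) + 1                     ∎)

  unitWeight-collapse : unitWeight (minor (fK L) ψ) + (boolToℕ (L i) + boolToℕ (L j))
                        ≡ count L + boolToℕ (not (L i xor L j))
  unitWeight-collapse = begin
    sum weight + (boolToℕ (L i) + boolToℕ (L j))  ≡⟨ cong (sum weight +_) looped-v₀ ⟨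
    sum weight + looped v₀                        ≡⟨ sum-exchange v₀ singletons ⟩
    sum looped + weight v₀                        ≡⟨ cong₂ _+_ (sum-over-fibres ψ L) (cong boolToℕ pair-value) ⟩
    count L + boolToℕ (not (L i xor L j))         ∎
    where
    weight looped : Fin (suc M) → ℕ
    weight v = boolToℕ (fK L (fibre v))
    looped v = count (λ u → L u ∧ fibre v u)
    singletons : ∀ v → v ≢ v₀ → weight v ≡ looped v
    singletons v v≢v₀ = fK-weight-1 L {fibre v} (trans (fibre-sizes v) (updateAt-minimal v v₀ (const 1) v≢v₀))
    outside : ∀ u → u ≢ i → u ≢ j → fibre v₀ u ≡ false
    outside = count≡2⇒pair (fibre v₀) i≢j fibre-i fibre-j (trans (fibre-sizes v₀) (updateAt-updates v₀ (const 1)))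
    looped-v₀ : looped v₀ ≡ boolToℕ (L i) + boolToℕ (L j)
    looped-v₀ = trans (sum-pair i≢j (λ u u≢i u≢j → boolToℕ-∧-false (L u) (outside u u≢i u≢j)))
                      (cong₂ _+_ (boolToℕ-∧-true (L i) fibre-i) (boolToℕ-∧-true (L j) fibre-j))
    pair-value : fK L (fibre v₀) ≡ not (L i xor L j)
    pair-value = fK-pair L i≢j fibre-i fibre-j outside

-- A top element is a minor along some τ identifying i and j. An identification of two vertices
-- of equal type lies below it, so its unit weight is fixed by i and j alone; computed through
-- its own identification it is k - 1 for two loops but k + 1 for two non-loops.
fK-not-joinIrreducible : ∀ {m} (L : Fin (suc (suc (suc (suc m)))) → Bool) {l₁ l₂ u₁ u₂} →
                         l₁ ≢ l₂ → L l₁ ≡ true → L l₂ ≡ true → u₁ ≢ u₂ → L u₁ ≡ false → L u₂ ≡ false →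
                         ¬ JoinIrreducible (suc (suc (suc (suc m))) , fK L)
fK-not-joinIrreducible L l₁≢l₂ Ll₁ Ll₂ u₁≢u₂ Lu₁ Lu₂ ((_ , top) , ((τ , top≡) , f⋠top) , below)
  with collision-or-injective τ
... | inj₂ τ-inj = f⋠top (≼-respʳ-≗ {h = _ , fK L} (sym ∘ top≡) (injective⇒≽minor (fK-cong L) τ τ-inj))
... | inj₁ (i , j , i≢j , τi≡τj) =
  unequal-gaps (by-type l₁≢l₂ Ll₁ Ll₂) (by-type u₁≢u₂ Lu₁ Lu₂) (through-top l₁≢l₂ (trans Ll₁ (sym Ll₂)))
               (through-top u₁≢u₂ (trans Lu₁ (sym Lu₂)))
  where
  weight : ∀ {a b} → a ≢ b → ℕ
  weight a≢b = unitWeight (identify (fK L) _ _ a≢b)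
  through-top : ∀ {a b} (a≢b : a ≢ b) → L a ≡ L b →
                weight a≢b + (boolToℕ (L i) + boolToℕ (L j)) ≡ count L + boolToℕ (not (L i xor L j))
  through-top {a} {b} a≢b La≡Lb with below (identify (fK L) a b a≢b) (identify-≺ (fK-cong L) a≢b (fK-essential L))
  ... | ρ , A≡top∘ρ = trans (cong (_+ (boolToℕ (L i) + boolToℕ (L j))) (sum-cong-≗ λ v → cong boolToℕ (A≡ (δ v))))
                            (unitWeight-collapse L (ρ ∘ τ) onto i≢j (cong ρ τi≡τj))
    where
    A≡ : ∀ α → proj₂ (identify (fK L) a b a≢b) α ≡ fK L (α ∘ ρ ∘ τ)
    A≡ α = trans (A≡top∘ρ α) (top≡ (α ∘ ρ))
    onto : ∀ v → ∃ λ u → ρ (τ u) ≡ v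
    onto v = essential⇒hit (fK-cong L) (ρ ∘ τ) A≡ (identify-essential L a≢b La≡Lb v)
  by-type : ∀ {a b s} (a≢b : a ≢ b) → L a ≡ s → L b ≡ s →
            weight a≢b + (boolToℕ s + boolToℕ s) ≡ count L + 1
  by-type {a} {b} a≢b refl Lb≡s = trans
    (subst (λ t → weight a≢b + (boolToℕ (L a) + boolToℕ t) ≡ count L + boolToℕ (not (L a xor t))) Lb≡s
      (unitWeight-collapse L (merge a b a≢b) (λ v → punchIn b v , merge-punchIn a≢b v) a≢b (merge-identifies a≢b)))
    (cong (λ c → count L + boolToℕ (not c)) (𝔹.xor-same (L a)))
  unequal-gaps : ∀ {w₁ w₀ k c e} → w₁ + 2 ≡ k + 1 → w₀ + 0 ≡ k + 1 → w₁ + c ≡ k + e → w₀ + c ≡ k + e → ⊥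
  unequal-gaps {w₁} {w₀} {c = c} loops non-loops loops′ non-loops′ =
    contradiction (ℕ.+-cancelˡ-≡ w₀ 2 0 (trans (cong (_+ 2) (sym w₁≡w₀)) (trans loops (sym non-loops)))) λ ()
    where
    w₁≡w₀ : w₁ ≡ w₀
    w₁≡w₀ = ℕ.+-cancelʳ-≡ c w₁ w₀ (trans loops′ (sym non-loops′))

-- Classification by the number of loops

fK-joinIrreducible-minority≤1 : ∀ {m} (L : Fin (suc (suc (suc m))) → Bool) (s : Bool) →
                                count (λ u → s xor L u) ≤ 1 → JoinIrreducible (suc (suc (suc m)) , fK L)
fK-joinIrreducible-minority≤1 {m} L s minority≤1 =
  let a , b , a≢b , a-major , b-major = count≥2⇒two majority majority≥2
  in fK-joinIrreducible L s a≢b (of-majority a-major) (of-majority b-major)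
       λ Li≡ Lj≡ → count≤1⇒unique (λ u → s xor L u) minority≤1 (to-minority Li≡) (to-minority Lj≡)
  where
  majority = λ u → not (s xor L u)
  majority≥2 : 2 ≤ count majority
  majority≥2 = ℕ.+-cancelˡ-≤ 1 2 (count majority) (ℕ.≤-trans (s≤s (s≤s (s≤s z≤n)))
                 (subst (_≤ 1 + count majority) (count-+-count-not (λ u → s xor L u))
                   (ℕ.+-monoˡ-≤ (count majority) minority≤1)))
  of-majority : ∀ {b} → not (s xor b) ≡ true → b ≡ s
  of-majority = agree s _
    where
    agree : ∀ s b → not (s xor b) ≡ true → b ≡ s
    agree false false _ = refl
    agree true  true  _ = refl
    agree false true  ()
    agree true  false ()
  to-minority : ∀ {b} → b ≡ not s → s xor b ≡ true
  to-minority refl = 𝔹.xor-inverseʳ s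

LoopCountCondition : ℕ → ℕ → Set
LoopCountCondition n k = k ≡ 0 ⊎ k ≡ 1 ⊎ k ≡ n ∸ 1 ⊎ k ≡ n

loopCount⇒fK-joinIrreducible : ∀ {m} (L : Fin (suc (suc m)) → Bool) →
                               LoopCountCondition (suc (suc m)) (count L) → JoinIrreducible (suc (suc m) , fK L)
loopCount⇒fK-joinIrreducible {zero}  L _ = fK-joinIrreducible₂ L
loopCount⇒fK-joinIrreducible {suc m} L (inj₁ k≡0) =
  fK-joinIrreducible-minority≤1 L false (subst (_≤ 1) (sym k≡0) z≤n)
loopCount⇒fK-joinIrreducible {suc m} L (inj₂ (inj₁ k≡1)) =
  fK-joinIrreducible-minority≤1 L false (subst (_≤ 1) (sym k≡1) ℕ.≤-refl)
loopCount⇒fK-joinIrreducible {suc m} L (inj₂ (inj₂ k≥n∸1)) =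
  fK-joinIrreducible-minority≤1 L true (ℕ.+-cancelˡ-≤ (suc (suc m)) _ 1
    (ℕ.≤-trans (ℕ.+-monoˡ-≤ (count (not ∘ L)) (large k≥n∸1))
               (ℕ.≤-reflexive (trans (count-+-count-not L) (ℕ.+-comm 1 (suc (suc m)))))))
  where
  large : count L ≡ suc (suc m) ⊎ count L ≡ suc (suc (suc m)) → suc (suc m) ≤ count L
  large (inj₁ k≡) = ℕ.≤-reflexive (sym k≡)
  large (inj₂ k≡) = subst (suc (suc m) ≤_) (sym k≡) (ℕ.n≤1+n _)

two-of-each⇒¬fK-joinIrreducible : ∀ {m} (L : Fin (suc (suc m)) → Bool) → 2 ≤ count L → 2 ≤ count (not ∘ L) →
                                  ¬ JoinIrreducible (suc (suc m) , fK L)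
two-of-each⇒¬fK-joinIrreducible {zero} L k≥2 k̄≥2 =
  contradiction (subst (4 ≤_) (count-+-count-not L) (ℕ.+-mono-≤ k≥2 k̄≥2)) λ { (s≤s (s≤s ())) }
two-of-each⇒¬fK-joinIrreducible {suc zero} L k≥2 k̄≥2 =
  contradiction (subst (4 ≤_) (count-+-count-not L) (ℕ.+-mono-≤ k≥2 k̄≥2)) λ { (s≤s (s≤s (s≤s ()))) }
two-of-each⇒¬fK-joinIrreducible {suc (suc m)} L k≥2 k̄≥2 =
  let l₁ , l₂ , l₁≢l₂ , Ll₁ , Ll₂ = count≥2⇒two L k≥2
      u₁ , u₂ , u₁≢u₂ , ¬Lu₁ , ¬Lu₂ = count≥2⇒two (not ∘ L) k̄≥2
  in fK-not-joinIrreducible L l₁≢l₂ Ll₁ Ll₂ u₁≢u₂ (𝔹.not-injective ¬Lu₁) (𝔹.not-injective ¬Lu₂)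

fK-joinIrreducible⇒loopCount : ∀ {m} (L : Fin (suc (suc m)) → Bool) → JoinIrreducible (suc (suc m) , fK L) →
                               LoopCountCondition (suc (suc m)) (count L)
fK-joinIrreducible⇒loopCount {m} L ji
  with count L ℕ.≟ 0 | count L ℕ.≟ 1 | count L ℕ.≟ suc m | count L ℕ.≟ suc (suc m)
... | yes k≡0 | _       | _         | _       = inj₁ k≡0
... | no _    | yes k≡1 | _         | _       = inj₂ (inj₁ k≡1)
... | no _    | no _    | yes k≡n∸1 | _       = inj₂ (inj₂ (inj₁ k≡n∸1))
... | no _    | no _    | no _      | yes k≡n = inj₂ (inj₂ (inj₂ k≡n))
... | no k≢0  | no k≢1  | no k≢n∸1  | no k≢n  =
  contradiction ji (two-of-each⇒¬fK-joinIrreducible L (≥2 k≢0 k≢1) (≥2 (k≢n ∘ k̄≡0) (k≢n∸1 ∘ k̄≡1)))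
  where
  ≥2 : ∀ {k} → k ≢ 0 → k ≢ 1 → 2 ≤ k
  ≥2 {zero}        k≢0 _   = contradiction refl k≢0
  ≥2 {suc zero}    _   k≢1 = contradiction refl k≢1
  ≥2 {suc (suc k)} _   _   = s≤s (s≤s z≤n)
  total : count L + count (not ∘ L) ≡ suc (suc m)
  total = count-+-count-not L
  k̄≡0 : count (not ∘ L) ≡ 0 → count L ≡ suc (suc m)
  k̄≡0 k̄≡ = trans (sym (ℕ.+-identityʳ (count L))) (trans (cong (count L +_) (sym k̄≡)) total)
  k̄≡1 : count (not ∘ L) ≡ 1 → count L ≡ suc m
  k̄≡1 k̄≡ = ℕ.suc-injective (trans (ℕ.+-comm 1 (count L)) (trans (cong (count L +_) (sym k̄≡)) total))

proposition4p15 : (n : ℕ) → 2 ≤ n → (G : Graph n) → IsCompleteSimplePart G →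
    (JoinIrreducible (boolFun G) ⇔
      (∣ loops G ∣ ≡ 0 ⊎ ∣ loops G ∣ ≡ 1 ⊎ ∣ loops G ∣ ≡ n ∸ 1 ⊎ ∣ loops G ∣ ≡ n))
proposition4p15 (suc (suc m)) (s≤s (s≤s z≤n)) G complete = mk⇔
  (subst (LoopCountCondition (suc (suc m))) (sym k≡) ∘ fK-joinIrreducible⇒loopCount L ∘ joinIrreducible-resp-≗ fG≗fK′)
  (joinIrreducible-resp-≗ (sym ∘ fG≗fK′) ∘ loopCount⇒fK-joinIrreducible L ∘ subst (LoopCountCondition (suc (suc m))) k≡)
  where
  L = lookup (loops G)
  fG≗fK′ : fG G ≗ fK L
  fG≗fK′ = fG≗fK G complete
  k≡ : ∣ loops G ∣ ≡ count L
  k≡ = ∣p∣≡count (loops G)
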